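{- Let $k,n\ge 1$, let $G=(V,E)$ be a graph with vertex set $V=\{1,\dots,k+1\}$, and let $u=(u_1,\dots,u_{k+1})$ be positive integers. Let $v=k+1$ and let $G-v$ be the graph on $\{1,\dots,k\}$ obtained from $G$ by deleting $v$ and all edges incident to $v$. For a positive integer $j$ define the $k$-tuple $j*u$ by $(j*u)_i=ju_i$ if $i$ is adjacent to $v$ in $G$, and $(j*u)_i=u_i$ otherwise, for $i=1,\dots,k$. Then $$Q_G^{(u)}(n)=\sum_{\substack{j=1\\ \gcd(j,u_{k+1})=1}}^{n} Q_{G-v}^{(j*u)}(n).$$
   Context: For a graph $H$ with vertex set $\{1,\dots,\ell\}$ and an $\ell$-tuple of positive integers $w=(w_1,\dots,w_\ell)$, $Q_H^{(w)}(n)$ denotes the number of $\ell$-tuples $(a_1,\dots,a_\ell)$ of integers with $1\le a_i\le n$ such that $\gcd(a_i,w_i)=1$ for all $i$ and $\gcd(a_i,a_j)=1$ for every edge $\{i,j\}$ of $H$. -}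

module Defs where

open import Data.Nat using (ℕ; zero; suc; _+_; _*_; _≟_)
open import Data.Nat.GCD using (gcd)
open import Data.Bool using (Bool; true; false; if_then_else_)
open import Data.Fin using (Fin; inject₁; fromℕ)
open import Data.Vec using (Vec; []; _∷_; lookup; tabulate)
open import Data.List using (List; []; _∷_; length; filter; map; concatMap; upTo)
open import Data.List.Relation.Unary.All using (All)
open import Data.Fin.Base using () renaming (toℕ to finToℕ)
open import Relation.Binary.PropositionalEquality using (_≡_)
open import Relation.Nullary using (Dec; yes; no; ¬_)
open import Relation.Nullary.Decidable using (_×-dec_)
open import Data.Product using (_×_)
open import Data.Fin using (_<_)

-- A (finite simple) graph on the vertex set Fin ℓ (vertex i ↔ paper's vertex i+1),
-- given by a symmetric irreflexive Boolean adjacency relation.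
record Graph (ℓ : ℕ) : Set where
  field
    adj   : Fin ℓ → Fin ℓ → Bool
    sym   : ∀ i j → adj i j ≡ adj j i
    irrfl : ∀ i → adj i i ≡ false
open Graph public

tuples : (ℓ n : ℕ) → List (Vec ℕ ℓ)
tuples zero    n = [] ∷ []
tuples (suc ℓ) n = concatMap (λ a → map (a ∷_) (tuples ℓ n)) (map suc (upTo n))

Good : {ℓ : ℕ} → Graph ℓ → Vec ℕ ℓ → Vec ℕ ℓ → Set
Good {ℓ} H w a =
  (∀ (i : Fin ℓ) → gcd (lookup a i) (lookup w i) ≡ 1) ×
  (∀ (i j : Fin ℓ) → adj H i j ≡ true → gcd (lookup a i) (lookup a j) ≡ 1)

all-fin? : ∀ {ℓ} (P : Fin ℓ → Set) → (∀ i → Dec (P i)) → Dec (∀ i → P i)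
all-fin? P d = Data.Fin.Properties.all? d
  where import Data.Fin.Properties

good? : {ℓ : ℕ} (H : Graph ℓ) (w a : Vec ℕ ℓ) → Dec (Good H w a)
good? H w a =
  all-fin? _ (λ i → gcd (lookup a i) (lookup w i) ≟ 1) ×-dec
  all-fin? _ (λ i → all-fin? _ (λ j → edge? i j))
  where
    edge? : ∀ i j → Dec (adj H i j ≡ true → gcd (lookup a i) (lookup a j) ≡ 1)
    edge? i j with adj H i j
    ... | false = yes (λ ())
    ... | true with gcd (lookup a i) (lookup a j) ≟ 1
    ...   | yes p = yes (λ _ → p)
    ...   | no ¬p = no (λ f → ¬p (f _≡_.refl))

Q : {ℓ : ℕ} → Graph ℓ → Vec ℕ ℓ → ℕ → ℕ
Q H w n = length (filter (good? H w) (tuples _ n))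

deleteLast : {k : ℕ} → Graph (suc k) → Graph k
deleteLast G = record
  { adj   = λ i j → adj G (inject₁ i) (inject₁ j)
  ; sym   = λ i j → sym G (inject₁ i) (inject₁ j)
  ; irrfl = λ i → irrfl G (inject₁ i) }

starMul : {k : ℕ} → Graph (suc k) → ℕ → Vec ℕ (suc k) → Vec ℕ k
starMul {k} G j u = tabulate λ i →
  if adj G (inject₁ i) (fromℕ k) then j * lookup u (inject₁ i) else lookup u (inject₁ i)

sumCoprime : ℕ → ℕ → (ℕ → ℕ) → ℕ
sumCoprime m zero    f = 0
sumCoprime m (suc n) f =
  sumCoprime m n f + (if Data.Nat._≡ᵇ_ (gcd (suc n) m) 1 then f (suc n) else 0)
  where import Data.Nat

{-# OPTIONS --safe #-}
module Submission where

-- Split each tuple (a₁,…,a_{k+1}) as (x, j) with j = a_{k+1}. The vertex condition at v says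
-- gcd(j, u_{k+1}) = 1; the conditions along edges {i, v} say gcd(x_i, j) = 1, and since
-- gcd(x_i, j u_i) = 1 ⇔ gcd(x_i, j) = 1 ∧ gcd(x_i, u_i) = 1 they merge with the vertex conditions at
-- the neighbours i of v into gcd(x_i, (j*u)_i) = 1. So for fixed j coprime to u_{k+1} the admissible
-- x are exactly those counted by Q_{G-v}^{(j*u)}(n), and for the other j there are none.

open import Defs hiding (sym)
open import Data.Bool using (Bool; true; false; if_then_else_)
open import Data.Fin as Fin using (Fin; inject₁; fromℕ)
open import Data.Fin.Relation.Unary.Top using (view; ‵fromℕ; ‵inject₁)
open import Data.List using (List; []; _∷_; _++_; length; filter; map; concatMap; upTo)
open import Data.List.Properties using (length-++; filter-++; filter-≐; filter-none; map-++; map-cong; upTo-∷ʳ)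
open import Data.List.Relation.Unary.All using (universal)
open import Data.Nat using (ℕ; zero; suc; _+_; _*_; _≤_; _≟_; _≡ᵇ_)
open import Data.Nat.Coprimality using (Coprime; coprime⇒gcd≡1; gcd≡1⇒coprime; coprime-divisor)
open import Data.Nat.Divisibility using (∣-trans; ∣m⇒∣m*n; ∣n⇒∣m*n)
open import Data.Nat.GCD using (gcd; gcd-comm)
open import Data.Nat.ListAction using (sum)
open import Data.Nat.ListAction.Properties using (sum-++)
open import Data.Nat.Properties using (+-identityʳ; +-commutativeSemigroup)
open import Algebra.Properties.CommutativeSemigroup +-commutativeSemigroup using (interchange)
open import Data.Product using (_×_; _,_; proj₁; proj₂; <_,_>; uncurry)
open import Data.Vec using (Vec; []; _∷_; _∷ʳ_; lookup; last)
open import Data.Vec.Properties using (lookup∘tabulate)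
open import Function.Bundles using (_⇔_; mk⇔; Equivalence)
open import Level using (0ℓ)
open import Relation.Binary.PropositionalEquality
open import Relation.Nullary using (Dec; yes; no; does)
open import Relation.Unary using (Pred; Decidable; _≐_)

private variable
  A B : Set
  k : ℕ

count : {P : Pred A 0ℓ} → Decidable P → List A → ℕ
count P? xs = length (filter P? xs)

∑ : List A → (A → ℕ) → ℕ
∑ xs f = sum (map f xs)

syntax ∑ xs (λ x → e) = ∑[ x ∈ xs ] e

oneTo : ℕ → List ℕ
oneTo n = map suc (upTo n)

∑-cong : {f g : A → ℕ} → (∀ x → f x ≡ g x) → (xs : List A) → ∑ xs f ≡ ∑ xs g
∑-cong f≗g xs = cong sum (map-cong f≗g xs)

∑-zero : (xs : List A) → ∑[ x ∈ xs ] 0 ≡ 0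
∑-zero []       = refl
∑-zero (x ∷ xs) = ∑-zero xs

∑-+ : (f g : A → ℕ) (xs : List A) → ∑[ x ∈ xs ] (f x + g x) ≡ ∑ xs f + ∑ xs g
∑-+ f g []       = refl
∑-+ f g (x ∷ xs) = trans (cong (f x + g x +_) (∑-+ f g xs)) (interchange (f x) (g x) _ _)

∑-comm : (f : A → B → ℕ) (xs : List A) (ys : List B) →
         ∑[ x ∈ xs ] ∑[ y ∈ ys ] f x y ≡ ∑[ y ∈ ys ] ∑[ x ∈ xs ] f x y
∑-comm f []       ys = sym (∑-zero ys)
∑-comm f (x ∷ xs) ys = trans (cong (∑ ys (f x) +_) (∑-comm f xs ys))
                             (sym (∑-+ (f x) (λ y → ∑[ x′ ∈ xs ] f x′ y) ys))

∑-∷ʳ : (f : A → ℕ) (xs : List A) (x : A) → ∑ (xs ++ x ∷ []) f ≡ ∑ xs f + f x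
∑-∷ʳ f xs x = begin
  sum (map f (xs ++ x ∷ []))       ≡⟨ cong sum (map-++ f xs (x ∷ [])) ⟩
  sum (map f xs ++ f x ∷ [])       ≡⟨ sum-++ (map f xs) (f x ∷ []) ⟩
  ∑ xs f + (f x + 0)               ≡⟨ cong (∑ xs f +_) (+-identityʳ (f x)) ⟩
  ∑ xs f + f x                     ∎
  where open ≡-Reasoning

sumCoprime≡∑ : (m n : ℕ) (f : ℕ → ℕ) →
               sumCoprime m n f ≡ ∑[ j ∈ oneTo n ] (if gcd j m ≡ᵇ 1 then f j else 0)
sumCoprime≡∑ m zero    f = refl
sumCoprime≡∑ m (suc n) f = begin
  sumCoprime m n f + g (suc n)          ≡⟨ cong (_+ g (suc n)) (sumCoprime≡∑ m n f) ⟩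
  ∑ (oneTo n) g + g (suc n)             ≡⟨ ∑-∷ʳ g (oneTo n) (suc n) ⟨
  ∑ (oneTo n ++ suc n ∷ []) g           ≡⟨ cong (λ js → ∑ js g) (map-++ suc (upTo n) (n ∷ [])) ⟨
  ∑ (map suc (upTo n ++ n ∷ [])) g      ≡⟨ cong (λ ns → ∑ (map suc ns) g) (upTo-∷ʳ n) ⟩
  ∑ (oneTo (suc n)) g                   ∎
  where
  open ≡-Reasoning
  g : ℕ → ℕ
  g j = if gcd j m ≡ᵇ 1 then f j else 0

module _ {P : Pred A 0ℓ} (P? : Decidable P) where

  count-++ : (xs ys : List A) → count P? (xs ++ ys) ≡ count P? xs + count P? ys
  count-++ xs ys = trans (cong length (filter-++ P? xs ys)) (length-++ (filter P? xs))

  count-map : (f : B → A) (xs : List B) → count P? (map f xs) ≡ count (λ x → P? (f x)) xs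
  count-map f []       = refl
  count-map f (x ∷ xs) with does (P? (f x))
  ... | true  = cong suc (count-map f xs)
  ... | false = count-map f xs

  count-concatMap : (f : B → List A) (xs : List B) →
                    count P? (concatMap f xs) ≡ ∑[ x ∈ xs ] count P? (f x)
  count-concatMap f []       = refl
  count-concatMap f (x ∷ xs) =
    trans (count-++ (f x) (concatMap f xs)) (cong (count P? (f x) +_) (count-concatMap f xs))

  count-≐ : {Q : Pred A 0ℓ} (Q? : Decidable Q) → P ≐ Q → (xs : List A) → count P? xs ≡ count Q? xs
  count-≐ Q? P≐Q xs = cong length (filter-≐ P? Q? P≐Q xs)

  count-if : {C : Set} {R : Pred A 0ℓ} (C? : Dec C) (R? : Decidable R) →
             (∀ x → P x ⇔ (C × R x)) → (xs : List A) →
             count P? xs ≡ (if does C? then count R? xs else 0)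
  count-if (yes c) R? P⇔C×R xs =
    count-≐ R? ((λ {x} p → proj₂ (to (P⇔C×R x) p)) , (λ {x} r → from (P⇔C×R x) (c , r))) xs
    where open Equivalence
  count-if (no ¬c) R? P⇔C×R xs =
    cong length (filter-none P? (universal (λ x p → ¬c (proj₁ (Equivalence.to (P⇔C×R x) p))) xs))

count-tuples-∷ : (ℓ n : ℕ) {P : Pred (Vec ℕ (suc ℓ)) 0ℓ} (P? : Decidable P) →
                 count P? (tuples (suc ℓ) n) ≡ ∑[ a ∈ oneTo n ] count (λ x → P? (a ∷ x)) (tuples ℓ n)
count-tuples-∷ ℓ n P? =
  trans (count-concatMap P? (λ a → map (a ∷_) (tuples ℓ n)) (oneTo n))
        (∑-cong (λ a → count-map P? (a ∷_) (tuples ℓ n)) (oneTo n))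

count-tuples-∷ʳ : (ℓ n : ℕ) {P : Pred (Vec ℕ (suc ℓ)) 0ℓ} (P? : Decidable P) →
                  count P? (tuples (suc ℓ) n) ≡ ∑[ j ∈ oneTo n ] count (λ x → P? (x ∷ʳ j)) (tuples ℓ n)
count-tuples-∷ʳ zero    n P? = trans (count-tuples-∷ zero n P?) (∑-cong agree (oneTo n))
  where
  agree : ∀ j → count (λ x → P? (j ∷ x)) (tuples zero n) ≡ count (λ x → P? (x ∷ʳ j)) (tuples zero n)
  agree j = count-≐ (λ x → P? (j ∷ x)) (λ x → P? (x ∷ʳ j))
                    ((λ { {[]} p → p }) , (λ { {[]} p → p })) (tuples zero n)
count-tuples-∷ʳ (suc ℓ) n P? = begin
  count P? (tuples (suc (suc ℓ)) n)
    ≡⟨ count-tuples-∷ (suc ℓ) n P? ⟩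
  ∑[ a ∈ oneTo n ] count (λ x → P? (a ∷ x)) (tuples (suc ℓ) n)
    ≡⟨ ∑-cong (λ a → count-tuples-∷ʳ ℓ n (λ x → P? (a ∷ x))) (oneTo n) ⟩
  ∑[ a ∈ oneTo n ] ∑[ j ∈ oneTo n ] count (λ x → P? (a ∷ (x ∷ʳ j))) (tuples ℓ n)
    ≡⟨ ∑-comm (λ a j → count (λ x → P? (a ∷ (x ∷ʳ j))) (tuples ℓ n)) (oneTo n) (oneTo n) ⟩
  ∑[ j ∈ oneTo n ] ∑[ a ∈ oneTo n ] count (λ x → P? (a ∷ (x ∷ʳ j))) (tuples ℓ n)
    ≡⟨ ∑-cong (λ j → count-tuples-∷ ℓ n (λ x → P? (x ∷ʳ j))) (oneTo n) ⟨
  ∑[ j ∈ oneTo n ] count (λ x → P? (x ∷ʳ j)) (tuples (suc ℓ) n)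
    ∎
  where open ≡-Reasoning

lookup-∷ʳ-inject₁ : (xs : Vec A k) (y : A) (i : Fin k) → lookup (xs ∷ʳ y) (inject₁ i) ≡ lookup xs i
lookup-∷ʳ-inject₁ (x ∷ xs) y Fin.zero    = refl
lookup-∷ʳ-inject₁ (x ∷ xs) y (Fin.suc i) = lookup-∷ʳ-inject₁ xs y i

lookup-∷ʳ-fromℕ : (xs : Vec A k) (y : A) → lookup (xs ∷ʳ y) (fromℕ k) ≡ y
lookup-∷ʳ-fromℕ []       y = refl
lookup-∷ʳ-fromℕ (x ∷ xs) y = lookup-∷ʳ-fromℕ xs y

lookup-fromℕ : (xs : Vec A (suc k)) → lookup xs (fromℕ k) ≡ last xs
lookup-fromℕ (x ∷ [])     = refl
lookup-fromℕ (x ∷ y ∷ xs) = lookup-fromℕ (y ∷ xs)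

coprime-*⇔ : {a b c : ℕ} → Coprime a (b * c) ⇔ (Coprime a b × Coprime a c)
coprime-*⇔ {a} {b} {c} = mk⇔ < coprimeˡ , coprimeʳ > (uncurry coprime-*)
  where
  coprimeˡ : Coprime a (b * c) → Coprime a b
  coprimeˡ a⊥bc (d∣a , d∣b) = a⊥bc (d∣a , ∣m⇒∣m*n c d∣b)
  coprimeʳ : Coprime a (b * c) → Coprime a c
  coprimeʳ a⊥bc (d∣a , d∣c) = a⊥bc (d∣a , ∣n⇒∣m*n b d∣c)
  coprime-* : Coprime a b → Coprime a c → Coprime a (b * c)
  coprime-* a⊥b a⊥c {d} (d∣a , d∣bc) = a⊥c (d∣a , coprime-divisor d⊥b d∣bc)
    where
    d⊥b : Coprime d b
    d⊥b (e∣d , e∣b) = a⊥b (∣-trans e∣d d∣a , e∣b)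

gcd-if-*≡1⇔ : (a j b : ℕ) (s : Bool) →
              gcd a (if s then j * b else b) ≡ 1 ⇔ ((s ≡ true → gcd a j ≡ 1) × gcd a b ≡ 1)
gcd-if-*≡1⇔ a j b true  = mk⇔
  (λ h → let a⊥j , a⊥b = to (gcd≡1⇒coprime {a} {j * b} h)
         in (λ _ → coprime⇒gcd≡1 a⊥j) , coprime⇒gcd≡1 a⊥b)
  (λ (h₁ , h₂) → coprime⇒gcd≡1 (from (gcd≡1⇒coprime {a} {j} (h₁ refl) , gcd≡1⇒coprime {a} {b} h₂)))
  where open Equivalence (coprime-*⇔ {a} {j} {b})
gcd-if-*≡1⇔ a j b false = mk⇔ (λ h → (λ ()) , h) proj₂

module _ {k : ℕ} (G : Graph (suc k)) (u : Vec ℕ (suc k)) (j : ℕ) (x : Vec ℕ k) where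

  private
    v : Fin (suc k)
    v = fromℕ k

  gcd-starMul≡1⇔ : (i : Fin k) →
    gcd (lookup x i) (lookup (starMul G j u) i) ≡ 1 ⇔
    ((adj G (inject₁ i) v ≡ true → gcd (lookup x i) j ≡ 1) × gcd (lookup x i) (lookup u (inject₁ i)) ≡ 1)
  gcd-starMul≡1⇔ i rewrite lookup∘tabulate
    (λ i → if adj G (inject₁ i) v then j * lookup u (inject₁ i) else lookup u (inject₁ i)) i =
    gcd-if-*≡1⇔ (lookup x i) j (lookup u (inject₁ i)) (adj G (inject₁ i) v)

  good-∷ʳ⇔ : Good G u (x ∷ʳ j) ⇔ (gcd j (last u) ≡ 1 × Good (deleteLast G) (starMul G j u) x)
  good-∷ʳ⇔ = mk⇔ restrict extend
    where
    open Equivalence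

    restrict : Good G u (x ∷ʳ j) → gcd j (last u) ≡ 1 × Good (deleteLast G) (starMul G j u) x
    restrict (vertex , edge) = j⊥last , vertex′ , edge′
      where
      j⊥last : gcd j (last u) ≡ 1
      j⊥last = subst₂ (λ a b → gcd a b ≡ 1) (lookup-∷ʳ-fromℕ x j) (lookup-fromℕ u) (vertex v)
      vertex′ : ∀ i → gcd (lookup x i) (lookup (starMul G j u) i) ≡ 1
      vertex′ i = from (gcd-starMul≡1⇔ i)
        ( (λ e → subst₂ (λ a b → gcd a b ≡ 1) (lookup-∷ʳ-inject₁ x j i) (lookup-∷ʳ-fromℕ x j)
                   (edge (inject₁ i) v e))
        , subst (λ a → gcd a _ ≡ 1) (lookup-∷ʳ-inject₁ x j i) (vertex (inject₁ i)))
      edge′ : ∀ a b → adj G (inject₁ a) (inject₁ b) ≡ true → gcd (lookup x a) (lookup x b) ≡ 1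
      edge′ a b e = subst₂ (λ a b → gcd a b ≡ 1) (lookup-∷ʳ-inject₁ x j a) (lookup-∷ʳ-inject₁ x j b)
                      (edge (inject₁ a) (inject₁ b) e)

    extend : gcd j (last u) ≡ 1 × Good (deleteLast G) (starMul G j u) x → Good G u (x ∷ʳ j)
    extend (j⊥last , vertex′ , edge′) = vertex , edge
      where
      neighbour : ∀ a → adj G (inject₁ a) v ≡ true → gcd (lookup x a) j ≡ 1
      neighbour a = proj₁ (to (gcd-starMul≡1⇔ a) (vertex′ a))
      vertex : ∀ i → gcd (lookup (x ∷ʳ j) i) (lookup u i) ≡ 1
      vertex i with view i
      ... | ‵fromℕ      rewrite lookup-∷ʳ-fromℕ x j | lookup-fromℕ u = j⊥last
      ... | ‵inject₁ a rewrite lookup-∷ʳ-inject₁ x j a = proj₂ (to (gcd-starMul≡1⇔ a) (vertex′ a))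
      edge : ∀ i i′ → adj G i i′ ≡ true → gcd (lookup (x ∷ʳ j) i) (lookup (x ∷ʳ j) i′) ≡ 1
      edge i i′ e with view i | view i′
      ... | ‵inject₁ a | ‵inject₁ b rewrite lookup-∷ʳ-inject₁ x j a | lookup-∷ʳ-inject₁ x j b =
        edge′ a b e
      ... | ‵inject₁ a | ‵fromℕ     rewrite lookup-∷ʳ-inject₁ x j a | lookup-∷ʳ-fromℕ x j =
        neighbour a e
      ... | ‵fromℕ     | ‵inject₁ b rewrite lookup-∷ʳ-fromℕ x j | lookup-∷ʳ-inject₁ x j b =
        trans (gcd-comm j (lookup x b)) (neighbour b (trans (Graph.sym G (inject₁ b) v) e))
      ... | ‵fromℕ     | ‵fromℕ     with () ← trans (sym e) (Graph.irrfl G v)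

lemma4 : (k n : ℕ) → 1 ≤ k → 1 ≤ n → (G : Graph (suc k)) → (u : Vec ℕ (suc k)) →
    (∀ (i : Fin (suc k)) → 1 ≤ lookup u i) →
    Q G u n ≡ sumCoprime (last u) n (λ j → Q (deleteLast G) (starMul G j u) n)
lemma4 k n _ _ G u _ = begin
  Q G u n
    ≡⟨ count-tuples-∷ʳ k n (good? G u) ⟩
  ∑[ j ∈ oneTo n ] count (λ x → good? G u (x ∷ʳ j)) (tuples k n)
    ≡⟨ ∑-cong (λ j → count-if (λ x → good? G u (x ∷ʳ j)) (gcd j (last u) ≟ 1)
                        (good? (deleteLast G) (starMul G j u)) (good-∷ʳ⇔ G u j) (tuples k n)) (oneTo n) ⟩
  ∑[ j ∈ oneTo n ] (if gcd j (last u) ≡ᵇ 1 then Q (deleteLast G) (starMul G j u) n else 0)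
    ≡⟨ sumCoprime≡∑ (last u) n (λ j → Q (deleteLast G) (starMul G j u) n) ⟨
  sumCoprime (last u) n (λ j → Q (deleteLast G) (starMul G j u) n)
    ∎
  where open ≡-Reasoning
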